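{- Let $k$ be a positive integer and write $k=5q+r$ with $q\in\mathbb N$, $0\le r\le4$. For $n\in\mathbb N$ define $\varphi_k$ on $SC_{5,n}$ by $\varphi_k(x,y)=(x+ky+2q,\,-kx+y-q)$ if $r=0$; $(-kx+y-q,\,-x-ky-2q-1)$ if $r=1$; $(-kx-y-q-1,\,-ky+x-2q-1)$ if $r=2$; $(kx-y+q,\,x+ky+2q+1)$ if $r=3$; $(-x-ky-2q-2,\,kx-y+q)$ if $r=4$. Then $\varphi_k$ is a well-defined injective map $SC_{5,n}\to SC_{5,(k^2+1)n+k^2}$.
   Context: $\mathbb N=\{0,1,2,\ldots\}$. A partition $\lambda$ is determined by its arm set $A^+(\lambda)=\{\lambda_i-i:1\le i\le s\}$ and leg set $L^+(\lambda)=\{\lambda^*_i-i:1\le i\le s\}$ ($s=\#\{i:\lambda_i\ge i\}$, $\lambda^*$ the conjugate); any two finite subsets of $\mathbb N$ of equal size are the leg and arm sets of a unique partition. For $c=(c_0,\ldots,c_{t-1})\in\mathbb Z^t$ with coordinate sum $0$, $\lambda_c$ is the partition with arm set $\{qt+j:0\le q<c_j\}$ and leg set $\{qt+t-j-1:0\le q<-c_j\}$. $SC_{t,n}$ is the set of such $c$ with $|\lambda_c|=n$ and $\lambda_c^*=\lambda_c$. For $t=5$, a pair $(x,y)\in\mathbb Z^2$ is identified with $(-y,-x,0,x,y)\in\mathbb Z^5$, and $SC_{5,n}$ is regarded as a set of such pairs. -}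

module Defs where

open import Data.Nat as ℕ using (ℕ; zero; suc; _/_)
open import Data.Nat.DivMod using (_mod_)
open import Data.Integer as ℤ using (ℤ; +_; -[1+_])
open import Data.Fin using (Fin; toℕ; zero; suc)
open import Data.Vec as Vec using (Vec; lookup; _∷_; [])
open import Data.List as List using (List; upTo; concatMap; allFin; length)
open import Data.List.Membership.Propositional using (_∈_)
open import Data.Product using (_×_; _,_)
open import Function.Bundles using (_⇔_)
open import Relation.Binary.PropositionalEquality using (_≡_)
open import Data.Nat.ListAction using (sum)

pos : ℤ → ℕ
pos (+ n)      = n
pos -[1+ n ]   = 0

neg : ℤ → ℕ
neg (+ n)      = 0
neg -[1+ n ]   = suc n

-- arm set of λ_c :  { q t + j : 0 ≤ q < c_j }   (as a duplicate-free list)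
armSet : (t : ℕ) → Vec ℤ t → List ℕ
armSet t c = concatMap (λ j → List.map (λ q → q ℕ.* t ℕ.+ toℕ j) (upTo (pos (lookup c j)))) (allFin t)

legSet : (t : ℕ) → Vec ℤ t → List ℕ
legSet t c = concatMap (λ j → List.map (λ q → q ℕ.* t ℕ.+ (t ℕ.∸ toℕ j ℕ.∸ 1)) (upTo (neg (lookup c j)))) (allFin t)

-- |λ| for the partition with Frobenius coordinates (arms a_i, legs b_i), 1 ≤ i ≤ s:
-- |λ| = Σ_i (a_i + b_i + 1) = s + Σ a_i + Σ b_i
size : (t : ℕ) → Vec ℤ t → ℕ
size t c = length (armSet t c) ℕ.+ sum (armSet t c) ℕ.+ sum (legSet t c)

-- λ_c^* = λ_c : the conjugate has arm and leg sets swapped, so this holds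
-- iff the arm set equals the leg set (as sets)
SelfConj : (t : ℕ) → Vec ℤ t → Set
SelfConj t c = ∀ m → (m ∈ armSet t c) ⇔ (m ∈ legSet t c)

SC : (t n : ℕ) → Vec ℤ t → Set
SC t n c = (Vec.foldr _ ℤ._+_ (+ 0) c ≡ + 0) × (size t c ≡ n) × SelfConj t c

embed5 : ℤ × ℤ → Vec ℤ 5
embed5 (x , y) = ℤ.- y ∷ ℤ.- x ∷ + 0 ∷ x ∷ y ∷ []

SC5 : ℕ → ℤ × ℤ → Set
SC5 n p = SC 5 n (embed5 p)

φcase : Fin 5 → ℤ → ℤ → ℤ × ℤ → ℤ × ℤ
φcase zero                         K Q (x , y) = (x ℤ.+ K ℤ.* y ℤ.+ + 2 ℤ.* Q , ℤ.- (K ℤ.* x) ℤ.+ y ℤ.- Q)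
φcase (suc zero)                   K Q (x , y) = (ℤ.- (K ℤ.* x) ℤ.+ y ℤ.- Q , ℤ.- x ℤ.- K ℤ.* y ℤ.- + 2 ℤ.* Q ℤ.- + 1)
φcase (suc (suc zero))             K Q (x , y) = (ℤ.- (K ℤ.* x) ℤ.- y ℤ.- Q ℤ.- + 1 , ℤ.- (K ℤ.* y) ℤ.+ x ℤ.- + 2 ℤ.* Q ℤ.- + 1)
φcase (suc (suc (suc zero)))       K Q (x , y) = (K ℤ.* x ℤ.- y ℤ.+ Q , x ℤ.+ K ℤ.* y ℤ.+ + 2 ℤ.* Q ℤ.+ + 1)
φcase (suc (suc (suc (suc zero)))) K Q (x , y) = (ℤ.- x ℤ.- K ℤ.* y ℤ.- + 2 ℤ.* Q ℤ.- + 2 , K ℤ.* x ℤ.- y ℤ.+ Q)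

φ : ℕ → ℤ × ℤ → ℤ × ℤ
φ k = φcase (k mod 5) (+ k) (+ (k / 5))

{-# OPTIONS --safe #-}
module Submission where

-- In the coordinates u = 5x + 1, v = 5y + 2 the size of the 5-core attached to (x , y) satisfies
-- 5 (|λ| + 1) = u² + v². Indeed the charge vector (-y, -x, 0, x, y) is antisymmetric, so λ is
-- self-conjugate and its leg set consists of its arm blocks in reverse order; summing these
-- arithmetic progressions gives |λ| = 5x² + 2x + 5y² + 4y. In the same coordinates φ_k is
-- multiplication by a Gaussian integer of norm k² + 1 (which one depends on k mod 5), so
-- multiplicativity of the norm gives |φ_k λ| + 1 = (k² + 1)(|λ| + 1), and φ_k is injective
-- because multiplication by a nonzero Gaussian integer is.

open import Defs
open import Data.Nat using (ℕ; _≤_; _+_; _*_)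
open import Data.Integer using (ℤ)
open import Data.Product using (_×_; _,_)
open import Relation.Binary.PropositionalEquality using (_≡_)

open import Data.Nat using (zero; suc; _∸_; _/_)
import Data.Nat.Properties as ℕP
open import Data.Nat.DivMod using (_mod_; _divMod_; module DivMod)
open import Data.Nat.ListAction using (sum)
open import Data.Nat.ListAction.Properties using (sum-++)
import Data.Nat.Tactic.RingSolver as ℕ-Ring
open import Data.Integer as ℤ using (+_; -[1+_]; NonZero)
import Data.Integer.Properties as ℤP
import Data.Integer.Tactic.RingSolver as ℤ-Ring
open import Algebra.Properties.AbelianGroup ℤP.+-0-abelianGroup using (∙-cancelʳ)
open import Data.Fin using (Fin; toℕ; opposite) renaming (zero to fzero; suc to fsuc)
open import Data.Fin.Properties using (opposite-prop; opposite-involutive)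
open import Data.Vec using (Vec; lookup; foldr)
open import Data.List as List using (List; []; _∷_; [_]; _++_; concat; concatMap; upTo; allFin; length)
open import Data.List.Properties using (concatMap-cong; map-++; upTo-∷ʳ; length-++)
open import Data.List.Membership.Propositional using (_∈_; lose)
open import Data.List.Membership.Propositional.Properties using (∈-concatMap⁺; ∈-concatMap⁻; ∈-allFin)
open import Data.List.Relation.Unary.Any using (satisfied)
open import Data.Product using (proj₁; proj₂; ∃-syntax)
open import Function.Base using (_∘_)
open import Function.Bundles using (_⇔_; mk⇔; module Equivalence)
open import Relation.Binary.PropositionalEquality using (refl; sym; trans; cong; cong₂; subst; module ≡-Reasoning)

infixl 7 _⊗_

_⊗_ : ℤ × ℤ → ℤ × ℤ → ℤ × ℤ
(a , b) ⊗ (u , v) = (a ℤ.* u ℤ.- b ℤ.* v , a ℤ.* v ℤ.+ b ℤ.* u)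

gaussNorm : ℤ × ℤ → ℤ
gaussNorm (a , b) = a ℤ.* a ℤ.+ b ℤ.* b

brahmagupta : ∀ a b u v →
  (a ℤ.* u ℤ.- b ℤ.* v) ℤ.* (a ℤ.* u ℤ.- b ℤ.* v) ℤ.+ (a ℤ.* v ℤ.+ b ℤ.* u) ℤ.* (a ℤ.* v ℤ.+ b ℤ.* u)
  ≡ (a ℤ.* a ℤ.+ b ℤ.* b) ℤ.* (u ℤ.* u ℤ.+ v ℤ.* v)
brahmagupta = ℤ-Ring.solve-∀

gaussNorm-⊗ : ∀ g w → gaussNorm (g ⊗ w) ≡ gaussNorm g ℤ.* gaussNorm w
gaussNorm-⊗ (a , b) (u , v) = brahmagupta a b u v

⊗-injective : ∀ g .{{_ : NonZero (gaussNorm g)}} {w w′} → g ⊗ w ≡ g ⊗ w′ → w ≡ w′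
⊗-injective g@(a , b) {u , v} {u′ , v′} eq = cong₂ _,_
  (ℤP.*-cancelˡ-≡ (gaussNorm g) u u′ (via re (re-conj a b u v) (re-conj a b u′ v′)))
  (ℤP.*-cancelˡ-≡ (gaussNorm g) v v′ (via im (im-conj a b u v) (im-conj a b u′ v′)))
  where
  -- re and im are the components of conj g ⊗ w, which is gaussNorm g times w
  re im : ℤ × ℤ → ℤ
  re (s , t) = a ℤ.* s ℤ.+ b ℤ.* t
  im (s , t) = a ℤ.* t ℤ.- b ℤ.* s
  via : ∀ f {x x′} → f (g ⊗ (u , v)) ≡ x → f (g ⊗ (u′ , v′)) ≡ x′ → x ≡ x′
  via f e e′ = trans (sym e) (trans (cong f eq) e′)
  re-conj : ∀ a b u v → a ℤ.* (a ℤ.* u ℤ.- b ℤ.* v) ℤ.+ b ℤ.* (a ℤ.* v ℤ.+ b ℤ.* u) ≡ (a ℤ.* a ℤ.+ b ℤ.* b) ℤ.* u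
  re-conj = ℤ-Ring.solve-∀
  im-conj : ∀ a b u v → a ℤ.* (a ℤ.* v ℤ.+ b ℤ.* u) ℤ.- b ℤ.* (a ℤ.* u ℤ.- b ℤ.* v) ≡ (a ℤ.* a ℤ.+ b ℤ.* b) ℤ.* v
  im-conj = ℤ-Ring.solve-∀

block : ℕ → ℕ → ℕ → List ℕ
block t b m = List.map (λ q → q * t + b) (upTo m)

armBlock : (t : ℕ) → Vec ℤ t → Fin t → List ℕ
armBlock t c j = block t (toℕ j) (pos (lookup c j))

Antisymmetric : (t : ℕ) → Vec ℤ t → Set
Antisymmetric t c = ∀ j → lookup c (opposite j) ≡ ℤ.- lookup c j

pos-neg : ∀ z → pos (ℤ.- z) ≡ neg z
pos-neg (+ zero)  = refl
pos-neg (+ suc n) = refl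
pos-neg -[1+ n ]  = refl

toℕ-opposite : ∀ {t} (j : Fin t) → toℕ (opposite j) ≡ t ∸ toℕ j ∸ 1
toℕ-opposite {t} j = begin
  toℕ (opposite j)  ≡⟨ opposite-prop j ⟩
  t ∸ suc (toℕ j)   ≡⟨ cong (t ∸_) (ℕP.+-comm 1 (toℕ j)) ⟩
  t ∸ (toℕ j + 1)   ≡⟨ ℕP.∸-+-assoc t (toℕ j) 1 ⟨
  t ∸ toℕ j ∸ 1     ∎
  where open ≡-Reasoning

legSet-antisymmetric : ∀ {t} (c : Vec ℤ t) → Antisymmetric t c →
                       legSet t c ≡ concatMap (armBlock t c ∘ opposite) (allFin t)
legSet-antisymmetric {t} c anti = concatMap-cong legBlock (allFin t)
  where
  legBlock : ∀ j → block t (t ∸ toℕ j ∸ 1) (neg (lookup c j)) ≡ armBlock t c (opposite j)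
  legBlock j = cong₂ (block t) (sym (toℕ-opposite j))
                     (trans (sym (pos-neg (lookup c j))) (cong pos (sym (anti j))))

∈-concatMap-allFin : ∀ {t} {f : Fin t → List ℕ} {m} → m ∈ concatMap f (allFin t) ⇔ (∃[ j ] m ∈ f j)
∈-concatMap-allFin {t} {f} = mk⇔ (satisfied ∘ ∈-concatMap⁻ f {allFin t})
                                 (λ (j , m∈fj) → ∈-concatMap⁺ f (lose (∈-allFin j) m∈fj))

∈-concatMap-opposite : ∀ {t} {f : Fin t → List ℕ} {m} →
                       m ∈ concatMap f (allFin t) ⇔ m ∈ concatMap (f ∘ opposite) (allFin t)
∈-concatMap-opposite {f = f} {m} = mk⇔
  (λ m∈f → let j , m∈fj = to (∈-concatMap-allFin {f = f}) m∈f in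
     from (∈-concatMap-allFin {f = f ∘ opposite})
          (opposite j , subst (λ i → m ∈ f i) (sym (opposite-involutive j)) m∈fj))
  (λ m∈f∘opp → let j , m∈fj = to (∈-concatMap-allFin {f = f ∘ opposite}) m∈f∘opp in
     from (∈-concatMap-allFin {f = f}) (opposite j , m∈fj))
  where open Equivalence

selfConj-antisymmetric : ∀ {t} (c : Vec ℤ t) → Antisymmetric t c → SelfConj t c
selfConj-antisymmetric {t} c anti m =
  subst (λ legs → (m ∈ armSet t c) ⇔ (m ∈ legs)) (sym (legSet-antisymmetric c anti))
        (∈-concatMap-opposite {f = armBlock t c})

weight : List ℕ → ℕ
weight xs = length xs + 2 * sum xs

weight-++ : ∀ xs ys → weight (xs ++ ys) ≡ weight xs + weight ys
weight-++ xs ys rewrite length-++ xs {ys} | sum-++ xs ys = regroup (length xs) (length ys) (sum xs) (sum ys)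
  where
  regroup : ∀ a b c d → a + b + 2 * (c + d) ≡ a + 2 * c + (b + 2 * d)
  regroup = ℕ-Ring.solve-∀

block-suc : ∀ t b m → block t b (suc m) ≡ block t b m ++ [ m * t + b ]
block-suc t b m = trans (cong (List.map f) (sym (upTo-∷ʳ m))) (map-++ f (upTo m) [ m ])
  where f = λ q → q * t + b

weight-block : ∀ t b m →
  + weight (block t b m) ≡ + m ℤ.* + m ℤ.* + t ℤ.+ + m ℤ.* (+ 2 ℤ.* + b ℤ.+ + 1 ℤ.- + t)
weight-block t b zero    = refl
weight-block t b (suc m) = begin
  + weight (block t b (suc m))                ≡⟨ cong (+_ ∘ weight) (block-suc t b m) ⟩
  + weight (block t b m ++ [ m * t + b ])     ≡⟨ cong +_ (weight-++ (block t b m) [ m * t + b ]) ⟩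
  + (weight (block t b m) + weight [ m * t + b ])
    ≡⟨ ℤP.pos-+ (weight (block t b m)) (weight [ m * t + b ]) ⟩
  + weight (block t b m) ℤ.+ + weight [ m * t + b ]
    ≡⟨ cong₂ ℤ._+_ (weight-block t b m) weight-last ⟩
  + m ℤ.* + m ℤ.* + t ℤ.+ + m ℤ.* (+ 2 ℤ.* + b ℤ.+ + 1 ℤ.- + t) ℤ.+ (+ 1 ℤ.+ + 2 ℤ.* (+ m ℤ.* + t ℤ.+ + b))
    ≡⟨ step (+ m) (+ t) (+ b) ⟩
  + suc m ℤ.* + suc m ℤ.* + t ℤ.+ + suc m ℤ.* (+ 2 ℤ.* + b ℤ.+ + 1 ℤ.- + t) ∎
  where
  open ≡-Reasoning
  weight-last : + weight [ m * t + b ] ≡ + 1 ℤ.+ + 2 ℤ.* (+ m ℤ.* + t ℤ.+ + b)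
  weight-last = begin
    + 1 ℤ.+ + (2 * (m * t + b + 0))   ≡⟨ cong (λ n → + 1 ℤ.+ n) (ℤP.pos-* 2 (m * t + b + 0)) ⟩
    + 1 ℤ.+ + 2 ℤ.* + (m * t + b + 0) ≡⟨ cong (λ n → + 1 ℤ.+ + 2 ℤ.* + n) (ℕP.+-identityʳ (m * t + b)) ⟩
    + 1 ℤ.+ + 2 ℤ.* + (m * t + b)     ≡⟨ cong (λ n → + 1 ℤ.+ + 2 ℤ.* n) (ℤP.pos-+ (m * t) b) ⟩
    + 1 ℤ.+ + 2 ℤ.* (+ (m * t) ℤ.+ + b) ≡⟨ cong (λ n → + 1 ℤ.+ + 2 ℤ.* (n ℤ.+ + b)) (ℤP.pos-* m t) ⟩
    + 1 ℤ.+ + 2 ℤ.* (+ m ℤ.* + t ℤ.+ + b) ∎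
  step : ∀ M T B →
    M ℤ.* M ℤ.* T ℤ.+ M ℤ.* (+ 2 ℤ.* B ℤ.+ + 1 ℤ.- T) ℤ.+ (+ 1 ℤ.+ + 2 ℤ.* (M ℤ.* T ℤ.+ B))
    ≡ (+ 1 ℤ.+ M) ℤ.* (+ 1 ℤ.+ M) ℤ.* T ℤ.+ (+ 1 ℤ.+ M) ℤ.* (+ 2 ℤ.* B ℤ.+ + 1 ℤ.- T)
  step = ℤ-Ring.solve-∀

-- Writing t as 1 + b + b′ makes the residues b and b′ mirror images (b + b′ = t - 1) without a
-- side condition, so the negative case is a pure ring identity.
weight-pair : ∀ b b′ z → let t = suc (b + b′) in
  + (weight (block t b (neg z)) + weight (block t b′ (pos z)))
  ≡ z ℤ.* z ℤ.* + t ℤ.+ z ℤ.* (+ 2 ℤ.* + b′ ℤ.+ + 1 ℤ.- + t)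
weight-pair b b′ (+ m)    = weight-block (suc (b + b′)) b′ m
weight-pair b b′ -[1+ m ] = trans (cong +_ (ℕP.+-identityʳ _))
                                  (trans (weight-block (suc (b + b′)) b (suc m)) (mirror (+ suc m) (+ b) (+ b′)))
  where
  mirror : ∀ M B B′ → let T = + 1 ℤ.+ (B ℤ.+ B′) in
    M ℤ.* M ℤ.* T ℤ.+ M ℤ.* (+ 2 ℤ.* B ℤ.+ + 1 ℤ.- T)
    ≡ ℤ.- M ℤ.* ℤ.- M ℤ.* T ℤ.+ ℤ.- M ℤ.* (+ 2 ℤ.* B′ ℤ.+ + 1 ℤ.- T)
  mirror = ℤ-Ring.solve-∀

length-concat : ∀ (xss : List (List ℕ)) → length (concat xss) ≡ sum (List.map length xss)
length-concat []         = refl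
length-concat (xs ∷ xss) = trans (length-++ xs) (cong (_+_ (length xs)) (length-concat xss))

sum-concat : ∀ (xss : List (List ℕ)) → sum (concat xss) ≡ sum (List.map sum xss)
sum-concat []         = refl
sum-concat (xs ∷ xss) = trans (sum-++ xs (concat xss)) (cong (_+_ (sum xs)) (sum-concat xss))

embed5-antisymmetric : ∀ p → Antisymmetric 5 (embed5 p)
embed5-antisymmetric (x , y) fzero                                = sym (ℤP.neg-involutive y)
embed5-antisymmetric (x , y) (fsuc fzero)                         = sym (ℤP.neg-involutive x)
embed5-antisymmetric (x , y) (fsuc (fsuc fzero))                  = refl
embed5-antisymmetric (x , y) (fsuc (fsuc (fsuc fzero)))           = refl
embed5-antisymmetric (x , y) (fsuc (fsuc (fsuc (fsuc fzero))))    = refl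

embed5-sum : ∀ p → foldr _ ℤ._+_ (+ 0) (embed5 p) ≡ + 0
embed5-sum (x , y) = cancel x y
  where
  cancel : ∀ x y → ℤ.- y ℤ.+ (ℤ.- x ℤ.+ (+ 0 ℤ.+ (x ℤ.+ (y ℤ.+ + 0)))) ≡ + 0
  cancel = ℤ-Ring.solve-∀

size-embed5 : ∀ x y → size 5 (embed5 (x , y)) ≡
  (weight (block 5 1 (neg x)) + weight (block 5 3 (pos x))) + (weight (block 5 0 (neg y)) + weight (block 5 4 (pos y)))
size-embed5 x y = begin
  size 5 (embed5 (x , y))
    ≡⟨ cong (λ legSet → length (concat arms) + sum (concat arms) + sum legSet)
            (legSet-antisymmetric (embed5 (x , y)) (embed5-antisymmetric (x , y))) ⟩
  length (concat arms) + sum (concat arms) + sum (concat legs)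
    ≡⟨ cong₂ _+_ (cong₂ _+_ (length-concat arms) (sum-concat arms)) (sum-concat legs) ⟩
  sum (List.map length arms) + sum (List.map sum arms) + sum (List.map sum legs)
    ≡⟨ regroup (length W₀) (length W₁) (length W₃) (length W₄) (sum W₀) (sum W₁) (sum W₃) (sum W₄) ⟩
  weight W₁ + weight W₃ + (weight W₀ + weight W₄)
    ≡⟨ cong₂ (λ m n → weight (block 5 1 m) + weight W₃ + (weight (block 5 0 n) + weight W₄))
             (pos-neg x) (pos-neg y) ⟩
  weight (block 5 1 (neg x)) + weight W₃ + (weight (block 5 0 (neg y)) + weight W₄) ∎
  where
  open ≡-Reasoning
  W₀ = block 5 0 (pos (ℤ.- y))
  W₁ = block 5 1 (pos (ℤ.- x))
  W₃ = block 5 3 (pos x)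
  W₄ = block 5 4 (pos y)
  arms legs : List (List ℕ)
  arms = W₀ ∷ W₁ ∷ W₃ ∷ W₄ ∷ []
  legs = W₄ ∷ W₃ ∷ W₁ ∷ W₀ ∷ []
  regroup : ∀ l₀ l₁ l₃ l₄ s₀ s₁ s₃ s₄ →
    l₀ + (l₁ + (l₃ + (l₄ + 0))) + (s₀ + (s₁ + (s₃ + (s₄ + 0)))) + (s₄ + (s₃ + (s₁ + (s₀ + 0))))
    ≡ l₁ + 2 * s₁ + (l₃ + 2 * s₃) + (l₀ + 2 * s₀ + (l₄ + 2 * s₄))
  regroup = ℕ-Ring.solve-∀

coords : ℤ × ℤ → ℤ × ℤ
coords (x , y) = (+ 5 ℤ.* x ℤ.+ + 1 , + 5 ℤ.* y ℤ.+ + 2)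

coords-injective : ∀ {p p′} → coords p ≡ coords p′ → p ≡ p′
coords-injective {x , y} {x′ , y′} eq = cong₂ _,_ (cancel (cong proj₁ eq)) (cancel (cong proj₂ eq))
  where
  cancel : ∀ {c z z′} → + 5 ℤ.* z ℤ.+ c ≡ + 5 ℤ.* z′ ℤ.+ c → z ≡ z′
  cancel {c} {z} {z′} e = ℤP.*-cancelˡ-≡ (+ 5) z z′ (∙-cancelʳ c (+ 5 ℤ.* z) (+ 5 ℤ.* z′) e)

gaussNorm-coords : ∀ p → gaussNorm (coords p) ≡ + (5 * suc (size 5 (embed5 p)))
gaussNorm-coords (x , y) = begin
  gaussNorm (coords (x , y))
    ≡⟨ completeSquares x y ⟨
  + 5 ℤ.* (+ 1 ℤ.+ (x ℤ.* x ℤ.* + 5 ℤ.+ x ℤ.* + 2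
                   ℤ.+ (y ℤ.* y ℤ.* + 5 ℤ.+ y ℤ.* + 4)))
    ≡⟨ cong (λ s → + 5 ℤ.* (+ 1 ℤ.+ s)) (cong₂ ℤ._+_ (weight-pair 1 3 x) (weight-pair 0 4 y)) ⟨
  + 5 ℤ.* (+ 1 ℤ.+ (+ wx ℤ.+ + wy))
    ≡⟨ cong (λ s → + 5 ℤ.* (+ 1 ℤ.+ s)) (ℤP.pos-+ wx wy) ⟨
  + 5 ℤ.* + suc (wx + wy)
    ≡⟨ ℤP.pos-* 5 (suc (wx + wy)) ⟨
  + (5 * suc (wx + wy))
    ≡⟨ cong (λ s → + (5 * suc s)) (size-embed5 x y) ⟨
  + (5 * suc (size 5 (embed5 (x , y)))) ∎
  where
  open ≡-Reasoning
  wx = weight (block 5 1 (neg x)) + weight (block 5 3 (pos x))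
  wy = weight (block 5 0 (neg y)) + weight (block 5 4 (pos y))
  completeSquares : ∀ x y →
    + 5 ℤ.* (+ 1 ℤ.+ (x ℤ.* x ℤ.* + 5 ℤ.+ x ℤ.* + 2
                     ℤ.+ (y ℤ.* y ℤ.* + 5 ℤ.+ y ℤ.* + 4)))
    ≡ (+ 5 ℤ.* x ℤ.+ + 1) ℤ.* (+ 5 ℤ.* x ℤ.+ + 1) ℤ.+ (+ 5 ℤ.* y ℤ.+ + 2) ℤ.* (+ 5 ℤ.* y ℤ.+ + 2)
  completeSquares = ℤ-Ring.solve-∀

multiplier : Fin 5 → ℤ → ℤ × ℤ
multiplier fzero                            K = (+ 1 , ℤ.- K)
multiplier (fsuc fzero)                     K = (ℤ.- K , ℤ.- + 1)
multiplier (fsuc (fsuc fzero))              K = (ℤ.- K , + 1)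
multiplier (fsuc (fsuc (fsuc fzero)))       K = (K , + 1)
multiplier (fsuc (fsuc (fsuc (fsuc fzero)))) K = (ℤ.- + 1 , K)

-- The identities are spelled out because the ring solver does not unfold coords, φcase or _⊗_.
coords-φcase : ∀ r Q K → K ≡ + toℕ r ℤ.+ Q ℤ.* + 5 →
               ∀ p → coords (φcase r K Q p) ≡ multiplier r K ⊗ coords p
coords-φcase fzero Q _ refl (x , y) = identity
  where
  identity : let K = + 0 ℤ.+ Q ℤ.* + 5; u = + 5 ℤ.* x ℤ.+ + 1; v = + 5 ℤ.* y ℤ.+ + 2 in
    (+ 5 ℤ.* (x ℤ.+ K ℤ.* y ℤ.+ + 2 ℤ.* Q) ℤ.+ + 1 , + 5 ℤ.* (ℤ.- (K ℤ.* x) ℤ.+ y ℤ.- Q) ℤ.+ + 2)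
    ≡ (+ 1 ℤ.* u ℤ.- ℤ.- K ℤ.* v , + 1 ℤ.* v ℤ.+ ℤ.- K ℤ.* u)
  identity = cong₂ _,_ (ℤ-Ring.solve (x ∷ y ∷ Q ∷ [])) (ℤ-Ring.solve (x ∷ y ∷ Q ∷ []))
coords-φcase (fsuc fzero) Q _ refl (x , y) = identity
  where
  identity : let K = + 1 ℤ.+ Q ℤ.* + 5; u = + 5 ℤ.* x ℤ.+ + 1; v = + 5 ℤ.* y ℤ.+ + 2 in
    (+ 5 ℤ.* (ℤ.- (K ℤ.* x) ℤ.+ y ℤ.- Q) ℤ.+ + 1 , + 5 ℤ.* (ℤ.- x ℤ.- K ℤ.* y ℤ.- + 2 ℤ.* Q ℤ.- + 1) ℤ.+ + 2)
    ≡ (ℤ.- K ℤ.* u ℤ.- ℤ.- + 1 ℤ.* v , ℤ.- K ℤ.* v ℤ.+ ℤ.- + 1 ℤ.* u)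
  identity = cong₂ _,_ (ℤ-Ring.solve (x ∷ y ∷ Q ∷ [])) (ℤ-Ring.solve (x ∷ y ∷ Q ∷ []))
coords-φcase (fsuc (fsuc fzero)) Q _ refl (x , y) = identity
  where
  identity : let K = + 2 ℤ.+ Q ℤ.* + 5; u = + 5 ℤ.* x ℤ.+ + 1; v = + 5 ℤ.* y ℤ.+ + 2 in
    (+ 5 ℤ.* (ℤ.- (K ℤ.* x) ℤ.- y ℤ.- Q ℤ.- + 1) ℤ.+ + 1 , + 5 ℤ.* (ℤ.- (K ℤ.* y) ℤ.+ x ℤ.- + 2 ℤ.* Q ℤ.- + 1) ℤ.+ + 2)
    ≡ (ℤ.- K ℤ.* u ℤ.- + 1 ℤ.* v , ℤ.- K ℤ.* v ℤ.+ + 1 ℤ.* u)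
  identity = cong₂ _,_ (ℤ-Ring.solve (x ∷ y ∷ Q ∷ [])) (ℤ-Ring.solve (x ∷ y ∷ Q ∷ []))
coords-φcase (fsuc (fsuc (fsuc fzero))) Q _ refl (x , y) = identity
  where
  identity : let K = + 3 ℤ.+ Q ℤ.* + 5; u = + 5 ℤ.* x ℤ.+ + 1; v = + 5 ℤ.* y ℤ.+ + 2 in
    (+ 5 ℤ.* (K ℤ.* x ℤ.- y ℤ.+ Q) ℤ.+ + 1 , + 5 ℤ.* (x ℤ.+ K ℤ.* y ℤ.+ + 2 ℤ.* Q ℤ.+ + 1) ℤ.+ + 2)
    ≡ (K ℤ.* u ℤ.- + 1 ℤ.* v , K ℤ.* v ℤ.+ + 1 ℤ.* u)
  identity = cong₂ _,_ (ℤ-Ring.solve (x ∷ y ∷ Q ∷ [])) (ℤ-Ring.solve (x ∷ y ∷ Q ∷ []))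
coords-φcase (fsuc (fsuc (fsuc (fsuc fzero)))) Q _ refl (x , y) = identity
  where
  identity : let K = + 4 ℤ.+ Q ℤ.* + 5; u = + 5 ℤ.* x ℤ.+ + 1; v = + 5 ℤ.* y ℤ.+ + 2 in
    (+ 5 ℤ.* (ℤ.- x ℤ.- K ℤ.* y ℤ.- + 2 ℤ.* Q ℤ.- + 2) ℤ.+ + 1 , + 5 ℤ.* (K ℤ.* x ℤ.- y ℤ.+ Q) ℤ.+ + 2)
    ≡ (ℤ.- + 1 ℤ.* u ℤ.- K ℤ.* v , ℤ.- + 1 ℤ.* v ℤ.+ K ℤ.* u)
  identity = cong₂ _,_ (ℤ-Ring.solve (x ∷ y ∷ Q ∷ [])) (ℤ-Ring.solve (x ∷ y ∷ Q ∷ []))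

gaussNorm-multiplier : ∀ r K → gaussNorm (multiplier r K) ≡ + 1 ℤ.+ K ℤ.* K
gaussNorm-multiplier fzero                             K = identity K
  where identity : ∀ K → + 1 ℤ.* + 1 ℤ.+ ℤ.- K ℤ.* ℤ.- K ≡ + 1 ℤ.+ K ℤ.* K
        identity = ℤ-Ring.solve-∀
gaussNorm-multiplier (fsuc fzero)                      K = identity K
  where identity : ∀ K → ℤ.- K ℤ.* ℤ.- K ℤ.+ ℤ.- + 1 ℤ.* ℤ.- + 1 ≡ + 1 ℤ.+ K ℤ.* K
        identity = ℤ-Ring.solve-∀
gaussNorm-multiplier (fsuc (fsuc fzero))               K = identity K
  where identity : ∀ K → ℤ.- K ℤ.* ℤ.- K ℤ.+ + 1 ℤ.* + 1 ≡ + 1 ℤ.+ K ℤ.* K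
        identity = ℤ-Ring.solve-∀
gaussNorm-multiplier (fsuc (fsuc (fsuc fzero)))        K = identity K
  where identity : ∀ K → K ℤ.* K ℤ.+ + 1 ℤ.* + 1 ≡ + 1 ℤ.+ K ℤ.* K
        identity = ℤ-Ring.solve-∀
gaussNorm-multiplier (fsuc (fsuc (fsuc (fsuc fzero)))) K = identity K
  where identity : ∀ K → ℤ.- + 1 ℤ.* ℤ.- + 1 ℤ.+ K ℤ.* K ≡ + 1 ℤ.+ K ℤ.* K
        identity = ℤ-Ring.solve-∀

coords-φ : ∀ k p → coords (φ k p) ≡ multiplier (k mod 5) (+ k) ⊗ coords p
coords-φ k = coords-φcase (k mod 5) (+ (k / 5)) (+ k) (begin
  + k                                          ≡⟨ cong +_ (DivMod.property (k divMod 5)) ⟩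
  + (toℕ (k mod 5) + k / 5 * 5)                ≡⟨ ℤP.pos-+ (toℕ (k mod 5)) (k / 5 * 5) ⟩
  + toℕ (k mod 5) ℤ.+ + (k / 5 * 5)            ≡⟨ cong (λ n → + toℕ (k mod 5) ℤ.+ n) (ℤP.pos-* (k / 5) 5) ⟩
  + toℕ (k mod 5) ℤ.+ + (k / 5) ℤ.* + 5        ∎)
  where open ≡-Reasoning

gaussNorm-multiplier-φ : ∀ k → gaussNorm (multiplier (k mod 5) (+ k)) ≡ + suc (k * k)
gaussNorm-multiplier-φ k =
  trans (gaussNorm-multiplier (k mod 5) (+ k)) (cong (λ n → + 1 ℤ.+ n) (sym (ℤP.pos-* k k)))

size-φ : ∀ k p → size 5 (embed5 (φ k p)) ≡ (k * k + 1) * size 5 (embed5 p) + k * k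
size-φ k p = unscale (k * k) (size 5 (embed5 p)) (size 5 (embed5 (φ k p))) (ℤP.+-injective (begin
  + (5 * suc (size 5 (embed5 (φ k p))))                   ≡⟨ gaussNorm-coords (φ k p) ⟨
  gaussNorm (coords (φ k p))                              ≡⟨ cong gaussNorm (coords-φ k p) ⟩
  gaussNorm (g ⊗ coords p)                                ≡⟨ gaussNorm-⊗ g (coords p) ⟩
  gaussNorm g ℤ.* gaussNorm (coords p)                    ≡⟨ cong₂ ℤ._*_ (gaussNorm-multiplier-φ k) (gaussNorm-coords p) ⟩
  + suc (k * k) ℤ.* + (5 * suc (size 5 (embed5 p)))       ≡⟨ ℤP.pos-* (suc (k * k)) _ ⟨
  + (suc (k * k) * (5 * suc (size 5 (embed5 p))))         ∎))
  where
  open ≡-Reasoning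
  g = multiplier (k mod 5) (+ k)
  unscale : ∀ a s s′ → 5 * suc s′ ≡ suc a * (5 * suc s) → s′ ≡ (a + 1) * s + a
  unscale a s s′ eq = ℕP.suc-injective (ℕP.*-cancelˡ-≡ (suc s′) _ 5 (trans eq (regroup a s)))
    where
    regroup : ∀ a s → suc a * (5 * suc s) ≡ 5 * suc ((a + 1) * s + a)
    regroup = ℕ-Ring.solve-∀

φ-injective : ∀ k {p p′} → φ k p ≡ φ k p′ → p ≡ p′
φ-injective k {p} {p′} eq = coords-injective (⊗-injective g {{nonZero}}
  (trans (sym (coords-φ k p)) (trans (cong coords eq) (coords-φ k p′))))
  where
  g = multiplier (k mod 5) (+ k)
  nonZero : NonZero (gaussNorm g)
  nonZero = subst NonZero (sym (gaussNorm-multiplier-φ k)) _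

proposition5p8 : (k : ℕ) → 1 ≤ k → (n : ℕ) →
    ((p : ℤ × ℤ) → SC5 n p → SC5 ((k * k + 1) * n + k * k) (φ k p))
    × ((p p′ : ℤ × ℤ) → SC5 n p → SC5 n p′ → φ k p ≡ φ k p′ → p ≡ p′)
proposition5p8 k _ n = preserves , (λ p p′ _ _ → φ-injective k)
  where
  preserves : (p : ℤ × ℤ) → SC5 n p → SC5 ((k * k + 1) * n + k * k) (φ k p)
  preserves p (_ , size≡n , _) =
    embed5-sum (φ k p) ,
    trans (size-φ k p) (cong (λ s → (k * k + 1) * s + k * k) size≡n) ,
    selfConj-antisymmetric (embed5 (φ k p)) (embed5-antisymmetric (φ k p))
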